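{- Let $a,b\ge 1$, $P=[a]\times[b]$, and for $f\in(\mathbb{R}^+)^P$ define $\Delta f\in(\mathbb{R}^+)^P$ by $(\Delta f)(i,j)=(\rho_{\mathcal{B}}^{\,j-1}f)(i,j)$ for $(i,j)\in P$. Then for all $f\in(\mathbb{R}^+)^P$, $$\Delta\rho_{\mathcal{B}} f=\pi_{\mathcal{B}}\Delta f.$$
   Context: $[a]\times[b]$ is ordered componentwise; $(i,j)$ covers $(i-1,j)$ and $(i,j-1)$ when these lie in $P$. $\hat P$ is $P$ with new minimum $\hat 0$ and maximum $\hat 1$, and functions are extended by $f(\hat 0)=f(\hat 1)=1$. For $x\in P$ the birational toggle $\phi_x$ changes only the value at $x$: $(\phi_x f)(x)=LR/f(x)$ with $L=\sum_{y\in\hat P,\,y\lessdot x} f(y)$ and $R$ the parallel sum of $\{f(y):y\in\hat P,\ y\gtrdot x\}$ (parallel sum of $s_1,\dots,s_m$ is $1/(1/s_1+\cdots+1/s_m)$). Birational rowmotion $\rho_{\mathcal{B}}$ is $\phi_{x_1}\circ\cdots\circ\phi_{x_{ab}}$ for a linear extension $x_1,\dots,x_{ab}$ of $P$ (toggle from top to bottom). The $i$-th file of $P$ is $\{(i',j)\in P: j-i'+a=i\}$, $1\le i\le a+b-1$; birational promotion $\pi_{\mathcal{B}}$ toggles all elements of file 1, then file 2, ..., then file $a+b-1$. -}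

module Defs where

open import Level using (Level; _⊔_) renaming (suc to lsuc)
open import Data.Nat using (ℕ; zero; suc; _∸_) renaming (_+_ to _+ℕ_)
open import Data.Nat using ( _≤_; _≤?_; _≟_)
open import Data.Bool using (Bool; true; false; if_then_else_; _∧_)
open import Data.List using (List; []; _∷_; _++_; map; upTo; concatMap; foldr; foldl; filter)
open import Data.Product using (_×_; _,_; proj₁; proj₂)
open import Relation.Nullary using (does)
open import Relation.Binary using (Rel; IsEquivalence)
open import Algebra.Definitions using (Congruent₂; Congruent₁; Associative; Commutative; LeftIdentity; _DistributesOverʳ_)

-- A semifield (commutative, no zero): the positive reals ℝ⁺ with
-- usual +, ·, 1, ⁻¹ are the motivating example.
record Semifield (c ℓ : Level) : Set (lsuc (c ⊔ ℓ)) where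
  infixl 7 _*_
  infixl 6 _+_
  infix 4 _≈_
  field
    Carrier       : Set c
    _≈_           : Rel Carrier ℓ
    _+_           : Carrier → Carrier → Carrier
    _*_           : Carrier → Carrier → Carrier
    1#            : Carrier
    _⁻¹           : Carrier → Carrier
    isEquivalence : IsEquivalence _≈_
    +-cong        : Congruent₂ _≈_ _+_
    *-cong        : Congruent₂ _≈_ _*_
    ⁻¹-cong       : Congruent₁ _≈_ _⁻¹
    +-assoc       : Associative _≈_ _+_
    +-comm        : Commutative _≈_ _+_
    *-assoc       : Associative _≈_ _*_
    *-comm        : Commutative _≈_ _*_
    *-identityˡ   : LeftIdentity _≈_ 1# _*_
    distribʳ      : _DistributesOverʳ_ _≈_ _*_ _+_
    inverseˡ      : ∀ x → (x ⁻¹) * x ≈ 1#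

iterate : ∀ {a} {A : Set a} → (A → A) → ℕ → A → A
iterate g zero    x = x
iterate g (suc n) x = g (iterate g n x)

-- Elements of P are pairs (i , j) of naturals with 1 ≤ i ≤ a, 1 ≤ j ≤ b.
-- Labelings are functions ℕ → ℕ → Carrier; only values on P matter
-- (all operations below read and write only values at points of P).
module Birational {c ℓ} (S : Semifield c ℓ) (a b : ℕ) where
  open Semifield S

  Labeling : Set c
  Labeling = ℕ → ℕ → Carrier

  -- sum of a list, where the empty list stands for the single value 1
  -- (the value at the adjoined element 0̂ resp. 1̂ of P̂)
  sumHat : List Carrier → Carrier
  sumHat []           = 1#
  sumHat (x ∷ [])     = x
  sumHat (x ∷ y ∷ ys) = x + sumHat (y ∷ ys)

  -- values f(y) for y ⋖ (i , j) in P̂ (0̂ handled by sumHat)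
  lowerVals : Labeling → ℕ → ℕ → List Carrier
  lowerVals f i j =
    (if does (2 ≤? i) then f (i ∸ 1) j ∷ [] else []) ++
    (if does (2 ≤? j) then f i (j ∸ 1) ∷ [] else [])

  -- values f(y) for y ⋗ (i , j) in P̂ (1̂ handled by sumHat)
  upperVals : Labeling → ℕ → ℕ → List Carrier
  upperVals f i j =
    (if does (suc i ≤? a) then f (suc i) j ∷ [] else []) ++
    (if does (suc j ≤? b) then f i (suc j) ∷ [] else [])

  L : Labeling → ℕ → ℕ → Carrier
  L f i j = sumHat (lowerVals f i j)

  R : Labeling → ℕ → ℕ → Carrier
  R f i j = (sumHat (map _⁻¹ (upperVals f i j))) ⁻¹

  toggle : ℕ × ℕ → Labeling → Labeling
  toggle (i , j) f k l =
    if does (k ≟ i) ∧ does (l ≟ j)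
    then L f i j * R f i j * (f i j) ⁻¹
    else f k l

  range : ℕ → List ℕ
  range n = map suc (upTo n)

  -- elements of P in lexicographic order: a linear extension x₁,…,x_ab
  elems : List (ℕ × ℕ)
  elems = concatMap (λ i → map (λ j → (i , j)) (range b)) (range a)

  rowmotion : Labeling → Labeling
  rowmotion f = foldr toggle f elems

  file : ℕ → List (ℕ × ℕ)
  file k = filter (λ x → proj₂ x +ℕ a ≟ k +ℕ proj₁ x) elems

  promotion : Labeling → Labeling
  promotion f =
    foldl (λ g x → toggle x g) f (concatMap file (range (a +ℕ b ∸ 1)))

  Δ : Labeling → Labeling
  Δ f i j = iterate rowmotion (j ∸ 1) f i j

module Submission where

-- Everything rests on one general fact about performing toggles one at a
-- time (`snapshot`): if a list of distinct points is toggled in order, the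
-- final value at a point x is the toggle of x computed from the labeling at
-- the moment x is toggled, and at that moment every neighbour that must be
-- toggled before x already carries its final value while every neighbour
-- that must come after x still carries its initial value.  Rowmotion toggles
-- P in reverse lexicographic order, promotion file by file, so the snapshot
-- gives local formulas `rowmotion-at` and `promotion-at`.  Writing ρ^n f for
-- the rowmotion orbit, the identity  π (Δ f)(i , j) = ρ^j f (i , j)  then
-- follows by induction on (j , a - i): the two formulas agree once the
-- neighbours (i , j-1) and (i+1 , j), lying in earlier files, satisfy it.
-- Finally Δ (ρ f)(i , j) = ρ^(j-1) (ρ f)(i , j) = ρ^j f (i , j).
-- No semifield axiom is used: the two sides are equal as formal expressions.

open import Defs
open import Data.Bool using (Bool; true; false; if_then_else_; _∧_)
open import Data.Bool.Properties using (∧-zeroʳ)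
open import Data.Nat using (ℕ; zero; suc; _+_; _∸_; _≤_; _<_; _≟_; _≤?_; z≤n; s≤s)
open import Data.Nat.Properties
  using ( ≤-reflexive; ≤-trans; <-irrefl; <-trans; <-asym; n<1+n
        ; +-suc; +-assoc; +-comm; +-cancelʳ-≡; +-cancelʳ-<; +-mono-≤; +-monoˡ-≤
        ; +-monoˡ-<; +-monoʳ-<; ∸-monoˡ-≤; m≤n⇒∃[o]m+o≡n; m≤m+n; n≤1+n; +-identityʳ
        ; +-commutativeSemigroup; module ≤-Reasoning )
open import Algebra.Properties.CommutativeSemigroup +-commutativeSemigroup
  using (xy∙z≈xz∙y; xy∙z≈x∙zy; x∙yz≈xz∙y)
open import Data.List using (List; []; _∷_; [_]; _++_; map; foldr; foldl; reverse; concatMap)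
open import Data.List.Properties using (unfold-reverse; reverse-involutive; foldr-ʳ++)
open import Data.List.Relation.Unary.All as All using (All; []; _∷_)
import Data.List.Relation.Unary.All.Properties as AllP
open import Data.List.Relation.Unary.AllPairs as AllPairs using (AllPairs; []; _∷_)
import Data.List.Relation.Unary.AllPairs.Properties as AllPairsP
open import Data.List.Relation.Unary.Any using (here; there)
import Data.List.Relation.Unary.Any.Properties as AnyP
open import Data.List.Membership.Propositional using (_∈_)
open import Data.List.Membership.Propositional.Properties
  using (∈-map⁺; ∈-map⁻; ∈-upTo⁺; ∈-concat⁺′; ∈-filter⁺; ∈-filter⁻)
open import Data.Product using (_×_; _,_; proj₁; proj₂)
open import Data.Sum using (_⊎_; inj₁; inj₂)
open import Data.Empty using (⊥-elim)
open import Function using (flip)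
open import Relation.Nullary using (Dec; yes; no; does; ¬_)
open import Relation.Nullary.Decidable using (dec-true; dec-false)
open import Relation.Binary using (IsEquivalence)
open import Relation.Binary.PropositionalEquality
  using (_≡_; _≢_; refl; sym; trans; cong; cong₂; module ≡-Reasoning)

iterate-shift : ∀ {c} {A : Set c} (g : A → A) n x → iterate g n (g x) ≡ g (iterate g n x)
iterate-shift g zero    x = refl
iterate-shift g (suc n) x = cong g (iterate-shift g n x)

allPairs-reverse : ∀ {a r} {A : Set a} {R : A → A → Set r} {xs : List A} →
                   AllPairs R xs → AllPairs (flip R) (reverse xs)
allPairs-reverse {xs = []} [] = []
allPairs-reverse {xs = x ∷ xs} (x-first ∷ rest) rewrite unfold-reverse x xs =
  AllPairsP.++⁺ (allPairs-reverse rest) ([] ∷ [])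
    (All.tabulate (λ y∈ → All.lookup x-first (AnyP.reverse⁻ y∈) ∷ []))

allPairs-restrict : ∀ {a p r} {A : Set a} {P : A → Set p} {R : A → A → Set r} {xs : List A} →
                    All P xs → AllPairs (λ x y → P x → P y → R x y) xs → AllPairs R xs
allPairs-restrict [] [] = []
allPairs-restrict (px ∷ pxs) (rx ∷ rxs) =
  All.zipWith (λ (r , py) → r px py) (rx , pxs) ∷ allPairs-restrict pxs rxs

guarded-cong : ∀ {a p} {A : Set a} {P : Set p} (d : Dec P) (x y : A) → (P → x ≡ y) →
               (if does d then [ x ] else []) ≡ (if does d then [ y ] else [])
guarded-cong (yes p) _ _ x≡y = cong [_] (x≡y p)
guarded-cong (no _)  _ _ _   = refl

if-true : ∀ {a} {A : Set a} {c : Bool} {x y : A} → c ≡ true → (if c then x else y) ≡ x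
if-true refl = refl

if-false : ∀ {a} {A : Set a} {c : Bool} {x y : A} → c ≡ false → (if c then x else y) ≡ y
if-false refl = refl

Point : Set
Point = ℕ × ℕ

-- Lexicographic order: `elems` lists P increasingly, so rowmotion toggles decreasingly.
_≺_ : Point → Point → Set
(i , j) ≺ (i' , j') = i < i' ⊎ (i ≡ i' × j < j')

≺-trans : ∀ {x y z} → x ≺ y → y ≺ z → x ≺ z
≺-trans (inj₁ p)          (inj₁ q)          = inj₁ (<-trans p q)
≺-trans (inj₁ p)          (inj₂ (refl , _)) = inj₁ p
≺-trans (inj₂ (refl , _)) (inj₁ q)          = inj₁ q
≺-trans (inj₂ (refl , p)) (inj₂ (refl , q)) = inj₂ (refl , <-trans p q)

≺-irrefl : ∀ {x} → ¬ x ≺ x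
≺-irrefl (inj₁ p)       = <-irrefl refl p
≺-irrefl (inj₂ (_ , p)) = <-irrefl refl p

≺-asym : ∀ {x y} → x ≺ y → ¬ y ≺ x
≺-asym p q = ≺-irrefl (≺-trans p q)

≺⇒≢ : ∀ {x y} → x ≺ y → x ≢ y
≺⇒≢ p refl = ≺-irrefl p

-- x ⊏ y: x lies in a strictly earlier file than y (the file of (i , j) is j - i up to shift).
_⊏_ : Point → Point → Set
(i , j) ⊏ (i' , j') = j + i' < j' + i

⊏-irrefl : ∀ {x} → ¬ x ⊏ x
⊏-irrefl = <-irrefl refl

below-≺ : ∀ {i j} → 2 ≤ i → (i ∸ 1 , j) ≺ (i , j)
below-≺ {suc (suc i)} (s≤s (s≤s _)) = inj₁ (n<1+n (suc i))

left-≺ : ∀ {i j} → 2 ≤ j → (i , j ∸ 1) ≺ (i , j)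
left-≺ {j = suc (suc j)} (s≤s (s≤s _)) = inj₂ (refl , n<1+n (suc j))

above-≺ : ∀ {i j} → (i , j) ≺ (suc i , j)
above-≺ {i} = inj₁ (n<1+n i)

right-≺ : ∀ {i j} → (i , j) ≺ (i , suc j)
right-≺ {j = j} = inj₂ (refl , n<1+n j)

below-later : ∀ {i j} → 2 ≤ i → (i , j) ⊏ (i ∸ 1 , j)
below-later {suc (suc i)} {j} (s≤s (s≤s _)) = +-monoʳ-< j (n<1+n (suc i))

left-earlier : ∀ {i j} → 2 ≤ j → (i , j ∸ 1) ⊏ (i , j)
left-earlier {i} {suc (suc j)} (s≤s (s≤s _)) = +-monoˡ-< i (n<1+n (suc j))

above-earlier : ∀ {i j} → (suc i , j) ⊏ (i , j)
above-earlier {i} {j} = +-monoʳ-< j (n<1+n i)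

right-later : ∀ {i j} → (i , j) ⊏ (i , suc j)
right-later {i} {j} = n<1+n (j + i)

module Intertwining {c ℓ} (S : Semifield c ℓ) (a b : ℕ) where
  open Semifield S using (_*_; _⁻¹)
  open Birational S a b

  guard-elsewhere : ∀ i j k l → (i , j) ≢ (k , l) → does (k ≟ i) ∧ does (l ≟ j) ≡ false
  guard-elsewhere i j k l x≢y with i ≟ k
  ... | no i≢k   = cong (_∧ does (l ≟ j)) (dec-false (k ≟ i) (λ k≡i → i≢k (sym k≡i)))
  ... | yes refl = trans (cong (does (k ≟ k) ∧_) (dec-false (l ≟ j) (λ { refl → x≢y refl })))
                         (∧-zeroʳ (does (k ≟ k)))

  guard-here : ∀ i j → does (i ≟ i) ∧ does (j ≟ j) ≡ true
  guard-here i j = cong₂ _∧_ (dec-true (i ≟ i) refl) (dec-true (j ≟ j) refl)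

  toggle-here : ∀ g i j → toggle (i , j) g i j ≡ L g i j * R g i j * (g i j) ⁻¹
  toggle-here g i j = if-true (guard-here i j)

  toggle-elsewhere : ∀ {x} g {k l} → x ≢ (k , l) → toggle x g k l ≡ g k l
  toggle-elsewhere {i , j} g {k} {l} x≢y = if-false (guard-elsewhere i j k l x≢y)

  L-local : ∀ g g' i j → (2 ≤ i → g (i ∸ 1) j ≡ g' (i ∸ 1) j) →
            (2 ≤ j → g i (j ∸ 1) ≡ g' i (j ∸ 1)) → L g i j ≡ L g' i j
  L-local g g' i j below left = cong sumHat lowers
    where
      lowers : lowerVals g i j ≡ lowerVals g' i j
      lowers = cong₂ _++_ (guarded-cong (2 ≤? i) (g (i ∸ 1) j) (g' (i ∸ 1) j) below)
                          (guarded-cong (2 ≤? j) (g i (j ∸ 1)) (g' i (j ∸ 1)) left)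

  R-local : ∀ g g' i j → (suc i ≤ a → g (suc i) j ≡ g' (suc i) j) →
            (suc j ≤ b → g i (suc j) ≡ g' i (suc j)) → R g i j ≡ R g' i j
  R-local g g' i j above right = cong (λ vs → sumHat (map _⁻¹ vs) ⁻¹) uppers
    where
      uppers : upperVals g i j ≡ upperVals g' i j
      uppers = cong₂ _++_ (guarded-cong (suc i ≤? a) (g (suc i) j) (g' (suc i) j) above)
                          (guarded-cong (suc j ≤? b) (g i (suc j)) (g' i (suc j)) right)

  run : List Point → Labeling → Labeling
  run ys g = foldl (λ h x → toggle x h) g ys

  run-untouched : ∀ ys g {k l} → All (_≢ (k , l)) ys → run ys g k l ≡ g k l
  run-untouched []       g []               = refl
  run-untouched (y ∷ ys) g (y≢ ∷ others≢) =
    trans (run-untouched ys (toggle y g) others≢) (toggle-elsewhere g y≢)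

  -- ys respects _⊲_ ("must be toggled before"): its points are distinct
  -- and no point is toggled after a point it must precede.
  Respects : (Point → Point → Set) → List Point → Set
  Respects _⊲_ = AllPairs (λ x y → x ≢ y × ¬ y ⊲ x)

  -- The labeling `state` seen when (i , j) is toggled during `run ys g`.
  record Snapshot (_⊲_ : Point → Point → Set) (ys : List Point) (g : Labeling) (i j : ℕ) : Set c where
    field
      state : Labeling
      value : run ys g i j ≡ L state i j * R state i j * (g i j) ⁻¹
      early : ∀ {k l} → (k , l) ⊲ (i , j) → state k l ≡ run ys g k l
      late  : ∀ {k l} → (i , j) ⊲ (k , l) → state k l ≡ g k l

  snapshot : ∀ {_⊲_} → (∀ {x} → ¬ x ⊲ x) → ∀ ys g {i j} → Respects _⊲_ ys → (i , j) ∈ ys →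
             Snapshot _⊲_ ys g i j
  snapshot ⊲-irrefl ((i , j) ∷ ys) g (x-first ∷ _) (here refl) = record
    { state = g
    ; value = trans
        (run-untouched ys (toggle (i , j) g) (All.map (λ (x≢y , _) y≡x → x≢y (sym y≡x)) x-first))
        (toggle-here g i j)
    ; early = λ n⊲x → sym (trans
        (run-untouched ys (toggle (i , j) g) (All.map (λ { (_ , y⋬x) refl → y⋬x n⊲x }) x-first))
        (toggle-elsewhere g (λ { refl → ⊲-irrefl n⊲x })))
    ; late  = λ _ → refl
    }
  snapshot {_⊲_} ⊲-irrefl (y ∷ ys) g {i} {j} (y-first ∷ rest) (there x∈) = record
    { state = state
    ; value = trans value (cong (λ v → L state i j * R state i j * v ⁻¹) (toggle-elsewhere g y≢x))
    ; early = early
    ; late  = λ x⊲n → trans (late x⊲n) (toggle-elsewhere g (λ { refl → x⋬y x⊲n }))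
    }
    where
      open Snapshot (snapshot ⊲-irrefl ys (toggle y g) rest x∈)
      y≢x : y ≢ (i , j)
      y≢x = proj₁ (All.lookup y-first x∈)
      x⋬y : ¬ (i , j) ⊲ y
      x⋬y = proj₂ (All.lookup y-first x∈)

  range-sorted : ∀ n → AllPairs _<_ (range n)
  range-sorted n = AllPairsP.map⁺ (AllPairsP.applyUpTo⁺₁ (λ k → k) n (λ k<l _ → s≤s k<l))

  ∈-range : ∀ {k n} → 1 ≤ k → k ≤ n → k ∈ range n
  ∈-range {suc k} _ k<n = ∈-map⁺ suc (∈-upTo⁺ k<n)

  row : ℕ → List Point
  row i = map (λ j → (i , j)) (range b)

  rows-ordered : ∀ {i i' x y} → i < i' → x ∈ row i → y ∈ row i' → x ≺ y
  rows-ordered {i} {i'} i<i' x∈ y∈ with ∈-map⁻ (i ,_) x∈ | ∈-map⁻ (i' ,_) y∈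
  ... | _ , _ , refl | _ , _ , refl = inj₁ i<i'

  elems-sorted : AllPairs _≺_ elems
  elems-sorted = AllPairsP.concat⁺
    (AllP.map⁺ (All.tabulate (λ _ →
      AllPairsP.map⁺ (AllPairs.map (λ j<j' → inj₂ (refl , j<j')) (range-sorted b)))))
    (AllPairsP.map⁺ (AllPairs.map
      (λ i<i' → All.tabulate (λ x∈ → All.tabulate (λ y∈ → rows-ordered i<i' x∈ y∈)))
      (range-sorted a)))

  ∈-elems : ∀ {i j} → 1 ≤ i → i ≤ a → 1 ≤ j → j ≤ b → (i , j) ∈ elems
  ∈-elems {i} 1≤i i≤a 1≤j j≤b =
    ∈-concat⁺′ (∈-map⁺ (i ,_) (∈-range 1≤j j≤b)) (∈-map⁺ row (∈-range 1≤i i≤a))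

  rowmotion-as-run : ∀ g → rowmotion g ≡ run (reverse elems) g
  rowmotion-as-run g = trans (cong (foldr toggle g) (sym (reverse-involutive elems)))
                             (foldr-ʳ++ toggle g (reverse elems))

  rowmotion-at : ∀ g i j → (i , j) ∈ elems →
                 rowmotion g i j ≡ L g i j * R (rowmotion g) i j * (g i j) ⁻¹
  rowmotion-at g i j x∈ rewrite rowmotion-as-run g =
    trans value (cong₂ (λ l r → l * r * (g i j) ⁻¹) lower upper)
    where
      reverse-respects : Respects (λ n x → x ≺ n) (reverse elems)
      reverse-respects = AllPairs.map (λ y≺x → (λ x≡y → ≺⇒≢ y≺x (sym x≡y)) , ≺-asym y≺x)
                                      (allPairs-reverse elems-sorted)
      open Snapshot (snapshot ≺-irrefl (reverse elems) g reverse-respects (AnyP.reverse⁺ x∈))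
      lower : L state i j ≡ L g i j
      lower = L-local state g i j (λ 2≤i → late (below-≺ 2≤i)) (λ 2≤j → late (left-≺ 2≤j))
      upper : R state i j ≡ R (run (reverse elems) g) i j
      upper = R-local state (run (reverse elems) g) i j (λ _ → early above-≺) (λ _ → early right-≺)

  OnFile : ℕ → Point → Set
  OnFile k x = proj₂ x + a ≡ k + proj₁ x

  on-file? : ∀ k x → Dec (OnFile k x)
  on-file? k x = proj₂ x + a ≟ k + proj₁ x

  on-file : ∀ {k x} → x ∈ file k → OnFile k x
  on-file {k} x∈ = proj₂ (∈-filter⁻ (on-file? k) {xs = elems} x∈)

  file-order : ∀ {k k' i j i' j'} → OnFile k (i , j) → OnFile k' (i' , j') → (i , j) ⊏ (i' , j') → k < k'
  file-order {k} {k'} {i} {j} {i'} {j'} on on' x⊏y = +-cancelʳ-< (i + i') k k' (begin-strict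
    k + (i + i')  ≡⟨ sym (+-assoc k i i') ⟩
    k + i + i'    ≡⟨ cong (_+ i') (sym on) ⟩
    j + a + i'    ≡⟨ xy∙z≈xz∙y j a i' ⟩
    j + i' + a    <⟨ +-monoˡ-< a x⊏y ⟩
    j' + i + a    ≡⟨ xy∙z≈xz∙y j' i a ⟩
    j' + a + i    ≡⟨ cong (_+ i) on' ⟩
    k' + i' + i   ≡⟨ xy∙z≈x∙zy k' i' i ⟩
    k' + (i + i') ∎)
    where open ≤-Reasoning

  file-respects : ∀ k → Respects _⊏_ (file k)
  file-respects k = allPairs-restrict (AllP.all-filter (on-file? k) elems)
    (AllPairsP.filter⁺ (on-file? k)
      (AllPairs.map (λ x≺y on on' → ≺⇒≢ x≺y , λ y⊏x → <-irrefl refl (file-order on' on y⊏x))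
                    elems-sorted))

  files-ordered : ∀ {k k' x y} → k < k' → OnFile k x → OnFile k' y → x ≢ y × ¬ y ⊏ x
  files-ordered {x = i , _} k<k' on on' =
    (λ { refl → <-irrefl (+-cancelʳ-≡ i _ _ (trans (sym on) on')) k<k' }) ,
    (λ y⊏x → <-asym k<k' (file-order on' on y⊏x))

  plist : List Point
  plist = concatMap file (range (a + b ∸ 1))

  plist-respects : Respects _⊏_ plist
  plist-respects = AllPairsP.concat⁺
    (AllP.map⁺ (All.tabulate (λ {k} _ → file-respects k)))
    (AllPairsP.map⁺ (AllPairs.map
      (λ k<k' → All.tabulate (λ x∈ → All.tabulate (λ y∈ →
                  files-ordered k<k' (on-file x∈) (on-file y∈))))
      (range-sorted (a + b ∸ 1))))

  -- (i , j) lies on file j + (a - i), which is among files 1, …, a + b - 1.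
  ∈-plist : ∀ {i j} → 1 ≤ i → i ≤ a → 1 ≤ j → j ≤ b → (i , j) ∈ plist
  ∈-plist {i} {j} 1≤i i≤a 1≤j j≤b with m≤n⇒∃[o]m+o≡n i≤a
  ... | u , i+u≡a =
    ∈-concat⁺′ (∈-filter⁺ (on-file? (j + u)) {xs = elems} (∈-elems 1≤i i≤a 1≤j j≤b) on)
               (∈-map⁺ file (∈-range (≤-trans 1≤j (m≤m+n j u)) (∸-monoˡ-≤ 1 bound)))
    where
      on : j + a ≡ j + u + i
      on = trans (cong (j +_) (sym i+u≡a)) (x∙yz≈xz∙y j i u)
      bound : suc (j + u) ≤ a + b
      bound = begin
        suc (j + u)  ≡⟨ sym (+-suc j u) ⟩
        j + suc u    ≤⟨ +-mono-≤ j≤b (+-monoˡ-≤ u 1≤i) ⟩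
        b + (i + u)  ≡⟨ cong (b +_) i+u≡a ⟩
        b + a        ≡⟨ +-comm b a ⟩
        a + b        ∎
        where open ≤-Reasoning

  -- Promotion at (i , j): the neighbours in earlier files, (i , j-1) and (i+1 , j),
  -- already carry their final values; those in later files, (i-1 , j) and (i , j+1),
  -- still carry their initial ones.
  promotion-at : ∀ h i j → (i , j) ∈ plist → ∀ G G' →
                 (2 ≤ i → G (i ∸ 1) j ≡ h (i ∸ 1) j) →
                 (2 ≤ j → G i (j ∸ 1) ≡ promotion h i (j ∸ 1)) →
                 (suc i ≤ a → G' (suc i) j ≡ promotion h (suc i) j) →
                 (suc j ≤ b → G' i (suc j) ≡ h i (suc j)) →
                 promotion h i j ≡ L G i j * R G' i j * (h i j) ⁻¹
  promotion-at h i j x∈ G G' below left above right =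
    trans value (cong₂ (λ l r → l * r * (h i j) ⁻¹) lower upper)
    where
      open Snapshot (snapshot (λ {x} → ⊏-irrefl {x}) plist h plist-respects x∈)
      lower : L state i j ≡ L G i j
      lower = L-local state G i j (λ 2≤i → trans (late (below-later {i} {j} 2≤i)) (sym (below 2≤i)))
                                  (λ 2≤j → trans (early (left-earlier {i} {j} 2≤j)) (sym (left 2≤j)))
      upper : R state i j ≡ R G' i j
      upper = R-local state G' i j (λ i<a → trans (early (above-earlier {i} {j})) (sym (above i<a)))
                                   (λ j<b → trans (late (right-later {i} {j})) (sym (right j<b)))

  module _ (f : Labeling) where
    orbit : ℕ → Labeling
    orbit n = iterate rowmotion n f

    promotion-step : ∀ i v → 1 ≤ i → i ≤ a → suc v ≤ b →
                     (2 ≤ suc v → promotion (Δ f) i v ≡ orbit v i v) →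
                     (suc i ≤ a → promotion (Δ f) (suc i) (suc v) ≡ orbit (suc v) (suc i) (suc v)) →
                     promotion (Δ f) i (suc v) ≡ orbit (suc v) i (suc v)
    promotion-step i v 1≤i i≤a j≤b left-done above-done = begin
      promotion (Δ f) i (suc v)
        ≡⟨ promotion-at (Δ f) i (suc v) (∈-plist 1≤i i≤a (s≤s z≤n) j≤b) (orbit v) (orbit (suc v))
             (λ _ → refl) (λ 2≤j → sym (left-done 2≤j)) (λ i<a → sym (above-done i<a)) (λ _ → refl) ⟩
      L (orbit v) i (suc v) * R (orbit (suc v)) i (suc v) * (orbit v i (suc v)) ⁻¹
        ≡⟨ sym (rowmotion-at (orbit v) i (suc v) (∈-elems 1≤i i≤a (s≤s z≤n) j≤b)) ⟩
      orbit (suc v) i (suc v) ∎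
      where open ≡-Reasoning

    promotion-of-Δ′ : ∀ u v i → i + u ≡ a → 1 ≤ i → suc v ≤ b →
                      promotion (Δ f) i (suc v) ≡ orbit (suc v) i (suc v)
    promotion-of-Δ′ u v i i+u≡a 1≤i j≤b =
      promotion-step i v 1≤i (≤-trans (m≤m+n i u) (≤-reflexive i+u≡a)) j≤b
                     (left v j≤b) (above u i+u≡a)
      where
        left : ∀ v → suc v ≤ b → 2 ≤ suc v → promotion (Δ f) i v ≡ orbit v i v
        left zero    _   (s≤s ())
        left (suc v') j≤b _ = promotion-of-Δ′ u v' i i+u≡a 1≤i (≤-trans (n≤1+n (suc v')) j≤b)
        above : ∀ u → i + u ≡ a → suc i ≤ a →
                promotion (Δ f) (suc i) (suc v) ≡ orbit (suc v) (suc i) (suc v)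
        above zero    i+0≡a i<a = ⊥-elim (<-irrefl (trans (sym (+-identityʳ i)) i+0≡a) i<a)
        above (suc u') i+u≡a _  =
          promotion-of-Δ′ u' v (suc i) (trans (sym (+-suc i u')) i+u≡a) (s≤s z≤n) j≤b

    promotion-of-Δ : ∀ i j → 1 ≤ i → i ≤ a → 1 ≤ j → j ≤ b → promotion (Δ f) i j ≡ orbit j i j
    promotion-of-Δ i (suc v) 1≤i i≤a _ j≤b with m≤n⇒∃[o]m+o≡n i≤a
    ... | u , i+u≡a = promotion-of-Δ′ u v i i+u≡a 1≤i j≤b

theorem8 : ∀ {c ℓ} (S : Semifield c ℓ) (a b : ℕ) → 1 ≤ a → 1 ≤ b →
           (f : ℕ → ℕ → Semifield.Carrier S) →
           ∀ i j → 1 ≤ i → i ≤ a → 1 ≤ j → j ≤ b →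
           Semifield._≈_ S (Birational.Δ S a b (Birational.rowmotion S a b f) i j)
                           (Birational.promotion S a b (Birational.Δ S a b f) i j)
theorem8 S a b _ _ f i (suc v) 1≤i i≤a 1≤j j≤b =
  IsEquivalence.reflexive (Semifield.isEquivalence S) (begin
    Δ (rowmotion f) i (suc v)    ≡⟨ cong (λ g → g i (suc v)) (iterate-shift rowmotion v f) ⟩
    orbit f (suc v) i (suc v)    ≡⟨ sym (promotion-of-Δ f i (suc v) 1≤i i≤a 1≤j j≤b) ⟩
    promotion (Δ f) i (suc v)    ∎)
  where
    open Birational S a b
    open Intertwining S a b
    open ≡-Reasoning
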